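{- Let $\sigma\ge n^{\Omega(1)}$. Any algorithm that computes all closed repeats in strings of length $n$ over a general ordered alphabet of size $\Theta(\sigma)$ spends $\Omega(n\log n)$ time on at least one input string of length $n$ that contains $O(n)$ closed repeats.
   Context: General ordered alphabet model: the alphabet is totally ordered and the only operation available on letters is a comparison determining their relative order, costing $O(1)$ time. For a string $s$ of length $n$, $s[i\,..\,j]=s[i]\cdots s[j]$. A non-empty substring $s[i\,..\,j]$ is a closed repeat if it has an occurrence $s[i'\,..\,j']=s[i\,..\,j]$ with $i'>i$ such that $s[i\,..\,j]$ does not occur at positions $i+1,\dots,i'-1$, and both (either $j'=n$ or $s[j+1]\ne s[j'+1]$) and (either $i=1$ or $s[i-1]\ne s[i'-1]$) hold; closed repeats at different positions are counted separately. Computing all closed repeats means outputting all pairs $(i,j)$ such that $s[i\,..\,j]$ is a closed repeat. -}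

module Defs where

open import Data.Nat using (ℕ; zero; suc; _+_; _*_; _∸_; _^_; _≤_; _<_)
open import Data.Nat.Logarithm using (⌊log₂_⌋)
open import Data.Fin using (Fin)
open import Data.Fin.Properties using (<-cmp)
open import Data.Vec using (Vec; []; _∷_; lookup)
open import Data.Maybe using (Maybe; just; nothing)
open import Data.List using (List; length)
open import Data.List.Membership.Propositional using (_∈_)
open import Data.Product using (Σ; ∃; _×_; _,_)
open import Data.Sum using (_⊎_)
open import Relation.Nullary using (¬_)
open import Relation.Binary.PropositionalEquality using (_≡_; _≢_)
open import Relation.Binary.Definitions using (tri<; tri≈; tri>)
open import Function.Bundles using (_⇔_)

-- A string of length n over a general ordered alphabet of
-- size k is a vector of letters from Fin k (every totally ordered set
-- of size k is order-isomorphic to Fin k).  Positions are 0-based.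

String : ℕ → ℕ → Set
String k n = Vec (Fin k) n

_‼_ : ∀ {A : Set} {n} → Vec A n → ℕ → Maybe A
[]       ‼ _       = nothing
(x ∷ xs) ‼ zero    = just x
(x ∷ xs) ‼ suc p   = xs ‼ p

-- Closed repeats (0-based translation of the paper's definition).
-- The substring s[i..j] has length  L = suc j ∸ i.
-- "s[i..j] occurs at position p" :

OccursAt : ∀ {k n} → String k n → (i j p : ℕ) → Set
OccursAt {n = n} s i j p =
  (p + (suc j ∸ i) ≤ n) ×
  (∀ t → t < suc j ∸ i → s ‼ (p + t) ≡ s ‼ (i + t))

ClosedRepeat : ∀ {k n} → String k n → (i j : ℕ) → Set
ClosedRepeat {n = n} s i j =
  (i ≤ j) × (j < n) ×
  Σ ℕ λ i' →
    (i < i') ×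
    OccursAt s i j i' ×
    (∀ p → i < p → p < i' → ¬ OccursAt s i j p) ×
    ((suc (i' + (j ∸ i)) ≡ n) ⊎ (s ‼ suc j ≢ s ‼ suc (i' + (j ∸ i)))) ×
    ((i ≡ 0) ⊎ (s ‼ (i ∸ 1) ≢ s ‼ (i' ∸ 1)))

AtMostClosedRepeats : ∀ {k n} → String k n → ℕ → Set
AtMostClosedRepeats s m =
  Σ (List (ℕ × ℕ)) λ ps →
    (length ps ≤ m) × (∀ i j → ClosedRepeat s i j → (i , j) ∈ ps)

-- Algorithms in the general ordered alphabet model, as (non-uniform)
-- comparison trees: each internal node compares the letters at two
-- positions of the input (three-way outcome <, =, >); leaves carry
-- the output.  Any algorithm in the model spends at least as much
-- time as the number of comparisons it performs.

data CTree (n : ℕ) (R : Set) : Set where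
  leaf : R → CTree n R
  cmp  : Fin n → Fin n → (lt eq gt : CTree n R) → CTree n R

run : ∀ {k n R} → CTree n R → String k n → R
run (leaf r)          s = r
run (cmp a b lt eq gt) s with <-cmp (lookup s a) (lookup s b)
... | tri< _ _ _ = run lt s
... | tri≈ _ _ _ = run eq s
... | tri> _ _ _ = run gt s

cost : ∀ {k n R} → CTree n R → String k n → ℕ
cost (leaf r)          s = 0
cost (cmp a b lt eq gt) s with <-cmp (lookup s a) (lookup s b)
... | tri< _ _ _ = suc (cost lt s)
... | tri≈ _ _ _ = suc (cost eq s)
... | tri> _ _ _ = suc (cost gt s)

ClosedRepeatAlgorithm : (σ : ℕ → ℕ) → Set
ClosedRepeatAlgorithm σ = (n : ℕ) → CTree n (List (ℕ × ℕ))

ComputesClosedRepeats : (σ : ℕ → ℕ) → ClosedRepeatAlgorithm σ → Set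
ComputesClosedRepeats σ A =
  ∀ n (s : String (σ n) n) i j → ((i , j) ∈ run (A n) s) ⇔ ClosedRepeat s i j

-- σ ≥ n^{Ω(1)} : there is d ≥ 1 such that σ(n) ≥ n^{1/d} eventually.
PolyLowerBounded : (ℕ → ℕ) → Set
PolyLowerBounded σ =
  Σ ℕ λ d → (1 ≤ d) × Σ ℕ λ N → ∀ n → N ≤ n → n ≤ σ n ^ d

{-# OPTIONS --safe #-}
-- A counting argument over comparison trees.  With K ≈ n^(1/D), the input for
-- a number c < K^m is cut into blocks of length b = e + 1; block q holds a
-- payload letter below K followed by the e base-K digits of q, written with the
-- letters K, …, 2K − 1.  As n ≤ K^e the block numbers are distinct, so no window
-- of length 2b occurs twice: closed repeats are shorter than 2b and there are
-- at most 2b·n of them.  The payloads of the first m blocks are the digits of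
-- c, the later ones run through 0, …, K − 1, so every payload letter recurs.
--
-- A correct tree cannot follow the same path on the inputs for c ≠ c'.  If it
-- did, it would follow it on the string pairing the letters of both inputs as
-- well, since that string compares like them wherever they compare alike, and
-- so report the same closed repeats for it.  Let q be the highest digit where c
-- and c' differ.  The payload of block q recurs in the input for c, so it lies
-- in a closed repeat; but in the paired string it never recurs, because beyond
-- block q the two inputs coincide.  Hence the K^m inputs reach distinct leaves
-- and one of them costs at least log₃ (K^m) = Ω((n / b) · (log n) / D).
module Submission where

open import Defs
open import Data.Fin using (Fin; toℕ; fromℕ<) renaming (_<_ to _<ᶠ_)
open import Data.Fin.Properties
  using (toℕ<n; toℕ-fromℕ<; fromℕ<-cong; fromℕ<-injective; pigeonhole; ¬∀⟶∃¬)
  renaming (<-cmp to <-cmpᶠ; _≟_ to _≟ᶠ_)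
open import Data.List using (List; applyUpTo)
open import Data.List.Membership.Propositional using (_∈_)
open import Data.List.Membership.Propositional.Properties using (∈-applyUpTo⁺)
open import Data.List.Properties using (length-applyUpTo)
open import Data.Maybe using (just; nothing)
open import Data.Maybe.Properties using (≡-dec; just-injective)
open import Data.Nat
  using (ℕ; zero; suc; pred; _+_; _*_; _∸_; _^_; _≤_; _<_; _≤?_; _<?_;
         NonZero; >-nonZero; >-nonZero⁻¹; z≤n; s≤s; z<s; ⌊_/2⌋; ⌈_/2⌉)
open import Data.Nat.Properties
open import Algebra.Properties.CommutativeSemigroup +-commutativeSemigroup using (xy∙z≈xz∙y)
open import Data.Nat.DivMod
  using (_/_; _%_; m≡m%n+[m/n]*n; m%n<n; [m+kn]%n≡m%n; m<n⇒m%n≡m; +-distrib-/-∣ʳ;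
         m<n⇒m/n≡0; m*n/n≡m; m<n*o⇒m/o<n; m/n*n≤m; /-monoˡ-≤)
open import Data.Nat.Divisibility using (n∣m*n)
open import Data.Nat.Logarithm
  using (⌊log₂_⌋; ⌊log₂⌋-mono-≤; ⌊log₂[2^n]⌋≡n; ⌊log₂⌊n/2⌋⌋≡⌊log₂n⌋∸1)
open import Data.Nat.Tactic.RingSolver using (solve-∀)
open import Data.Product using (Σ; ∃; ∃₂; _×_; _,_; proj₁; proj₂)
open import Data.Sum using (_⊎_; inj₁; inj₂)
open import Data.Vec using (Vec; []; _∷_; tabulate; lookup)
open import Data.Vec.Properties using (lookup∘tabulate)
open import Function using (_∘_)
open import Function.Bundles using (_⇔_; Equivalence)
open import Relation.Binary.Definitions using (Tri; tri<; tri≈; tri>)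
open import Relation.Binary.PropositionalEquality
open import Relation.Nullary using (¬_; yes; no; contradiction)
open import Relation.Unary using (Decidable)

-- Division, powers and binary logarithms

[r+q*d]/d≡q : ∀ {d} .{{_ : NonZero d}} {r} q → r < d → (r + q * d) / d ≡ q
[r+q*d]/d≡q {d} {r} q r<d = begin
  (r + q * d) / d     ≡⟨ +-distrib-/-∣ʳ r (n∣m*n q) ⟩
  r / d + q * d / d   ≡⟨ cong₂ _+_ (m<n⇒m/n≡0 r<d) (m*n/n≡m q d) ⟩
  q                   ∎
  where open ≡-Reasoning

[r+q*d]%d≡r : ∀ {d} .{{_ : NonZero d}} {r} q → r < d → (r + q * d) % d ≡ r
[r+q*d]%d≡r {d} {r} q r<d = trans ([m+kn]%n≡m%n r q d) (m<n⇒m%n≡m r<d)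

divMod-injective : ∀ {d} .{{_ : NonZero d}} {r r' q q'} → r < d → r' < d →
                   r + q * d ≡ r' + q' * d → r ≡ r' × q ≡ q'
divMod-injective {d} {r} {r'} {q} {q'} r<d r'<d h =
  trans (sym ([r+q*d]%d≡r q r<d)) (trans (cong (_% d) h) ([r+q*d]%d≡r q' r'<d)) ,
  trans (sym ([r+q*d]/d≡q q r<d)) (trans (cong (_/ d) h) ([r+q*d]/d≡q q' r'<d))

m+o+[n∸m]≡n+o : ∀ {m n} o → m ≤ n → m + o + (n ∸ m) ≡ n + o
m+o+[n∸m]≡n+o {m} {n} o m≤n = begin
  m + o + (n ∸ m) ≡⟨ +-assoc m o (n ∸ m) ⟩
  m + (o + (n ∸ m)) ≡⟨ cong (m +_) (+-comm o (n ∸ m)) ⟩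
  m + ((n ∸ m) + o) ≡⟨ +-assoc m (n ∸ m) o ⟨
  m + (n ∸ m) + o ≡⟨ cong (_+ o) (m+[n∸m]≡n m≤n) ⟩
  n + o ∎
  where open ≡-Reasoning

m<o⇒n<o+[n∸m] : ∀ {m n o} → m < o → m ≤ n → n < o + (n ∸ m)
m<o⇒n<o+[n∸m] {m} {n} {o} m<o m≤n = subst (_< o + (n ∸ m)) (m+[n∸m]≡n m≤n) (+-monoˡ-< (n ∸ m) m<o)

n<2^n : ∀ n → n < 2 ^ n
n<2^n zero    = s≤s z≤n
n<2^n (suc n) = +-mono-≤ (m^n>0 2 n) (subst (suc n ≤_) (sym (+-identityʳ (2 ^ n))) (n<2^n n))

^-cancelˡ-≤ : ∀ d .{{_ : NonZero d}} {x y} → x ^ d ≤ y ^ d → x ≤ y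
^-cancelˡ-≤ d x^d≤y^d = ≮⇒≥ λ y<x → <⇒≱ (^-monoˡ-< d y<x) x^d≤y^d

2^-cancel-≤ : ∀ {x y} → 2 ^ x ≤ 2 ^ y → x ≤ y
2^-cancel-≤ 2^x≤2^y = ≮⇒≥ λ y<x → <⇒≱ (^-monoʳ-< 2 (s≤s (s≤s z≤n)) y<x) 2^x≤2^y

n≤[b+b]*[n/b∸K] : ∀ b .{{_ : NonZero b}} K {n} → (b + b) * suc K ≤ n → n ≤ (b + b) * (n / b ∸ K)
n≤[b+b]*[n/b∸K] b K {n} large = subst (n ≤_) (sym (*-distribˡ-∸ (b + b) (n / b) K))
  (m+n≤o⇒m≤o∸n n (<⇒≤ (+-cancelʳ-< (b + b) _ _ (begin-strict
    n + (b + b) * K + (b + b)          ≡⟨ regroup n (b + b) K ⟩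
    n + (b + b) * suc K                ≤⟨ +-monoʳ-≤ n large ⟩
    n + n                              <⟨ +-mono-< n<[1+q]b n<[1+q]b ⟩
    suc (n / b) * b + suc (n / b) * b  ≡⟨ double (n / b) b ⟩
    (b + b) * (n / b) + (b + b)        ∎))))
  where
  open ≤-Reasoning
  regroup : ∀ n c K → n + c * K + c ≡ n + c * suc K
  regroup = solve-∀
  double : ∀ q b → suc q * b + suc q * b ≡ (b + b) * q + (b + b)
  double = solve-∀
  n<[1+q]b : n < suc (n / b) * b
  n<[1+q]b = subst (_< suc (n / b) * b) (sym (m≡m%n+[m/n]*n n b)) (+-monoˡ-< (n / b * b) (m%n<n n b))

2^≤⇒≤⌊log₂⌋ : ∀ {L n} → 2 ^ L ≤ n → L ≤ ⌊log₂ n ⌋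
2^≤⇒≤⌊log₂⌋ {L} 2^L≤n = subst (_≤ _) (⌊log₂[2^n]⌋≡n L) (⌊log₂⌋-mono-≤ 2^L≤n)

≤⌊log₂⌋⇒2^≤ : ∀ L {n} → 1 ≤ n → L ≤ ⌊log₂ n ⌋ → 2 ^ L ≤ n
≤⌊log₂⌋⇒2^≤ zero    1≤n _ = 1≤n
≤⌊log₂⌋⇒2^≤ (suc L) {n} 1≤n L<log = begin
  2 ^ L + (2 ^ L + 0)   ≤⟨ +-mono-≤ IH (≤-trans (≤-reflexive (+-identityʳ _)) IH) ⟩
  ⌊ n /2⌋ + ⌊ n /2⌋     ≤⟨ +-monoʳ-≤ ⌊ n /2⌋ (⌊n/2⌋≤⌈n/2⌉ n) ⟩
  ⌊ n /2⌋ + ⌈ n /2⌉     ≡⟨ ⌊n/2⌋+⌈n/2⌉≡n n ⟩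
  n                     ∎
  where
  open ≤-Reasoning
  2≤n : 2 ≤ n
  2≤n = ≰⇒> λ n≤1 → contradiction (≤-trans L<log (⌊log₂⌋-mono-≤ n≤1)) λ ()
  IH : 2 ^ L ≤ ⌊ n /2⌋
  IH = ≤⌊log₂⌋⇒2^≤ L (⌊n/2⌋-mono 2≤n) (subst (L ≤_) (sym (⌊log₂⌊n/2⌋⌋≡⌊log₂n⌋∸1 n))
         (m+n≤o⇒m≤o∸n L (subst (_≤ ⌊log₂ n ⌋) (+-comm 1 L) L<log)))

n<2^[1+⌊log₂n⌋] : ∀ n → n < 2 ^ suc ⌊log₂ n ⌋
n<2^[1+⌊log₂n⌋] n = ≰⇒> λ 2^[1+L]≤n → 1+n≰n (2^≤⇒≤⌊log₂⌋ 2^[1+L]≤n)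

-- Maximal runs of a decidable predicate

_holdsOn[_,_] : (ℕ → Set) → ℕ → ℕ → Set
P holdsOn[ i , j ] = ∀ x → i ≤ x → x ≤ j → P x

StartOfRun : (ℕ → Set) → ℕ → Set
StartOfRun P i = i ≡ 0 ⊎ ∃ λ i₋ → i ≡ suc i₋ × ¬ P i₋

module _ {P : ℕ → Set} where

  holdsOn-single : ∀ {p} → P p → P holdsOn[ p , p ]
  holdsOn-single Pp x p≤x x≤p = subst P (≤-antisym p≤x x≤p) Pp

  holdsOn-cons : ∀ {i j} → P i → P holdsOn[ suc i , j ] → P holdsOn[ i , j ]
  holdsOn-cons Pi run x i≤x x≤j with m≤n⇒m<n∨m≡n i≤x
  ... | inj₁ i<x  = run x i<x x≤j
  ... | inj₂ refl = Pi

  holdsOn-snoc : ∀ {i j} → P holdsOn[ i , j ] → P (suc j) → P holdsOn[ i , suc j ]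
  holdsOn-snoc run Psj x i≤x x≤sj with m≤n⇒m<n∨m≡n x≤sj
  ... | inj₁ x<sj = run x i≤x (m<1+n⇒m≤n x<sj)
  ... | inj₂ refl = Psj

  holdsOn-join : ∀ {i p j} → P holdsOn[ i , p ] → P holdsOn[ p , j ] → P holdsOn[ i , j ]
  holdsOn-join left right x i≤x x≤j with ≤-total x _
  ... | inj₁ x≤p = left x i≤x x≤p
  ... | inj₂ p≤x = right x p≤x x≤j

  module _ (P? : Decidable P) where

    least-above : ∀ d {p} → P (d + p) →
                  ∃ λ y → p ≤ y × y ≤ d + p × P y × (∀ x → p ≤ x → x < y → ¬ P x)
    least-above d {p} Pq with P? p
    ... | yes Pp = p , ≤-refl , m≤n+m p d , Pp , λ x p≤x x<p _ → <⇒≱ x<p p≤x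
    least-above zero        Pq | no ¬Pp = contradiction Pq ¬Pp
    least-above (suc d) {p} Pq | no ¬Pp
      with y , p<y , y≤ , Py , below ← least-above d {suc p} (subst P (sym (+-suc d p)) Pq)
      = y , <⇒≤ p<y , subst (y ≤_) (+-suc d p) y≤ , Py , below′
      where
      below′ : ∀ x → p ≤ x → x < y → ¬ P x
      below′ x p≤x x<y with m≤n⇒m<n∨m≡n p≤x
      ... | inj₁ p<x  = below x p<x x<y
      ... | inj₂ refl = ¬Pp

    run-leftwards : ∀ p → P p →
                    ∃ λ i → i ≤ p × P holdsOn[ i , p ] × StartOfRun P i
    run-leftwards zero    P0 = 0 , ≤-refl , holdsOn-single P0 , inj₁ refl
    run-leftwards (suc p) Psp with P? p
    ... | no ¬Pp = suc p , ≤-refl , holdsOn-single Psp , inj₂ (p , refl , ¬Pp)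
    ... | yes Pp with i , i≤p , run , start ← run-leftwards p Pp
      = i , m≤n⇒m≤1+n i≤p , holdsOn-snoc run Psp , start

    run-rightwards : ∀ d {p} → P p → ¬ P (d + p) →
                     ∃ λ j → p ≤ j × j < d + p × P holdsOn[ p , j ] × ¬ P (suc j)
    run-rightwards zero        Pp ¬Pq = contradiction Pp ¬Pq
    run-rightwards (suc d) {p} Pp ¬Pq with P? (suc p)
    ... | no ¬Psp = p , ≤-refl , s≤s (m≤n+m p d) , holdsOn-single Pp , ¬Psp
    ... | yes Psp with j , sp≤j , j< , run , end ← run-rightwards d Psp (¬Pq ∘ subst P (+-suc d p))
      = j , <⇒≤ sp≤j , subst (j <_) (+-suc d p) j< , holdsOn-cons Pp run , end

-- Comparison trees

data Outcome : Set where
  less equal greater : Outcome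

outcome : ∀ {A B C : Set} → Tri A B C → Outcome
outcome (tri< _ _ _) = less
outcome (tri≈ _ _ _) = equal
outcome (tri> _ _ _) = greater

select : ∀ {A : Set} → Outcome → A → A → A → A
select less    x _ _ = x
select equal   _ y _ = y
select greater _ _ z = z

rank : Outcome → ℕ
rank less    = 0
rank equal   = 1
rank greater = 2

rank<3 : ∀ o → rank o < 3
rank<3 less    = s≤s z≤n
rank<3 equal   = s≤s (s≤s z≤n)
rank<3 greater = s≤s (s≤s (s≤s z≤n))

rank-injective : ∀ {o o'} → rank o ≡ rank o' → o ≡ o'
rank-injective {less}    {less}    _ = refl
rank-injective {equal}   {equal}   _ = refl
rank-injective {greater} {greater} _ = refl
rank-injective {less}    {equal}   ()
rank-injective {less}    {greater} ()
rank-injective {equal}   {less}    ()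
rank-injective {equal}   {greater} ()
rank-injective {greater} {less}    ()
rank-injective {greater} {equal}   ()

data Holds (A B C : Set) : Outcome → Set where
  holds< : A → Holds A B C less
  holds≈ : B → Holds A B C equal
  holds> : C → Holds A B C greater

module _ {A B C : Set} where

  outcome-holds : (t : Tri A B C) → Holds A B C (outcome t)
  outcome-holds (tri< a _ _) = holds< a
  outcome-holds (tri≈ _ b _) = holds≈ b
  outcome-holds (tri> _ _ c) = holds> c

  holds⇒outcome : ∀ {o} (t : Tri A B C) → Holds A B C o → outcome t ≡ o
  holds⇒outcome (tri< _ _ _)  (holds< _) = refl
  holds⇒outcome (tri≈ _ _ _)  (holds≈ _) = refl
  holds⇒outcome (tri> _ _ _)  (holds> _) = refl
  holds⇒outcome (tri< _ ¬b _) (holds≈ b) = contradiction b ¬b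
  holds⇒outcome (tri< _ _ ¬c) (holds> c) = contradiction c ¬c
  holds⇒outcome (tri≈ ¬a _ _) (holds< a) = contradiction a ¬a
  holds⇒outcome (tri≈ _ _ ¬c) (holds> c) = contradiction c ¬c
  holds⇒outcome (tri> ¬a _ _) (holds< a) = contradiction a ¬a
  holds⇒outcome (tri> _ ¬b _) (holds≈ b) = contradiction b ¬b

compareℕ : ℕ → ℕ → Outcome
compareℕ x y = outcome (<-cmp x y)

compareᶠ-toℕ : ∀ {k} (x y : Fin k) → outcome (<-cmpᶠ x y) ≡ compareℕ (toℕ x) (toℕ y)
compareᶠ-toℕ x y =
  sym (holds⇒outcome (<-cmp (toℕ x) (toℕ y)) (toℕ-holds (outcome-holds (<-cmpᶠ x y))))
  where
  toℕ-holds : ∀ {o} → Holds (x <ᶠ y) (x ≡ y) (y <ᶠ x) o →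
              Holds (toℕ x < toℕ y) (toℕ x ≡ toℕ y) (toℕ y < toℕ x) o
  toℕ-holds (holds< x<y) = holds< x<y
  toℕ-holds (holds≈ x≡y) = holds≈ (cong toℕ x≡y)
  toℕ-holds (holds> y<x) = holds> y<x

compareℕ-pair : ∀ W {x₁ y₁ x₂ y₂} → compareℕ x₁ y₁ ≡ compareℕ x₂ y₂ →
                compareℕ (x₂ + x₁ * W) (y₂ + y₁ * W) ≡ compareℕ x₁ y₁
compareℕ-pair W {x₁} {y₁} {x₂} {y₂} same = holds⇒outcome (<-cmp _ _)
  (pair (outcome-holds (<-cmp x₁ y₁)) (subst (Holds _ _ _) (sym same) (outcome-holds (<-cmp x₂ y₂))))
  where
  X Y : ℕ
  X = x₂ + x₁ * W
  Y = y₂ + y₁ * W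
  pair : ∀ {o} → Holds (x₁ < y₁) (x₁ ≡ y₁) (y₁ < x₁) o → Holds (x₂ < y₂) (x₂ ≡ y₂) (y₂ < x₂) o →
         Holds (X < Y) (X ≡ Y) (Y < X) o
  pair (holds< x₁<y₁) (holds< x₂<y₂) = holds< (+-mono-<-≤ x₂<y₂ (*-monoˡ-≤ W (<⇒≤ x₁<y₁)))
  pair (holds≈ x₁≡y₁) (holds≈ x₂≡y₂) = holds≈ (cong₂ (λ u v → v + u * W) x₁≡y₁ x₂≡y₂)
  pair (holds> y₁<x₁) (holds> y₂<x₂) = holds> (+-mono-<-≤ y₂<x₂ (*-monoˡ-≤ W (<⇒≤ y₁<x₁)))

outcomeAt : ∀ {k n} → String k n → Fin n → Fin n → Outcome
outcomeAt s a b = outcome (<-cmpᶠ (lookup s a) (lookup s b))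

module _ {k n : ℕ} {R : Set} where

  data SamePath (s t : String k n) : CTree n R → Set where
    leaf : ∀ {r} → SamePath s t (leaf r)
    node : ∀ {a b l e g} → outcomeAt s a b ≡ outcomeAt t a b →
           SamePath s t (select (outcomeAt s a b) l e g) → SamePath s t (cmp a b l e g)

  leafIndex : CTree n R → String k n → ℕ
  leafIndex (leaf _)        s = 0
  leafIndex (cmp a b l e g) s with <-cmpᶠ (lookup s a) (lookup s b)
  ... | tri< _ _ _ = rank less    + leafIndex l s * 3
  ... | tri≈ _ _ _ = rank equal   + leafIndex e s * 3
  ... | tri> _ _ _ = rank greater + leafIndex g s * 3

  module _ (a b : Fin n) (l e g : CTree n R) (s : String k n) where

    private
      branch : CTree n R
      branch = select (outcomeAt s a b) l e g

    run-cmp : run (cmp a b l e g) s ≡ run branch s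
    run-cmp with <-cmpᶠ (lookup s a) (lookup s b)
    ... | tri< _ _ _ = refl
    ... | tri≈ _ _ _ = refl
    ... | tri> _ _ _ = refl

    cost-cmp : cost (cmp a b l e g) s ≡ suc (cost branch s)
    cost-cmp with <-cmpᶠ (lookup s a) (lookup s b)
    ... | tri< _ _ _ = refl
    ... | tri≈ _ _ _ = refl
    ... | tri> _ _ _ = refl

    leafIndex-cmp : leafIndex (cmp a b l e g) s ≡ rank (outcomeAt s a b) + leafIndex branch s * 3
    leafIndex-cmp with <-cmpᶠ (lookup s a) (lookup s b)
    ... | tri< _ _ _ = refl
    ... | tri≈ _ _ _ = refl
    ... | tri> _ _ _ = refl

  samePath-run : ∀ {s t} {T : CTree n R} → SamePath s t T → run T s ≡ run T t
  samePath-run leaf = refl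
  samePath-run {s} {t} {cmp a b l e g} (node o≡ p) = begin
    run (cmp a b l e g) s                  ≡⟨ run-cmp a b l e g s ⟩
    run (select (outcomeAt s a b) l e g) s ≡⟨ samePath-run p ⟩
    run (select (outcomeAt s a b) l e g) t ≡⟨ cong (λ o → run (select o l e g) t) o≡ ⟩
    run (select (outcomeAt t a b) l e g) t ≡⟨ run-cmp a b l e g t ⟨
    run (cmp a b l e g) t                  ∎
    where open ≡-Reasoning

  samePath-transfer : ∀ {s t u} {T : CTree n R} →
                      (∀ a b → outcomeAt s a b ≡ outcomeAt t a b → outcomeAt s a b ≡ outcomeAt u a b) →
                      SamePath s t T → SamePath s u T
  samePath-transfer h leaf         = leaf
  samePath-transfer h (node o≡ p) = node (h _ _ o≡) (samePath-transfer h p)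

  leafIndex<3^cost : ∀ T s → leafIndex T s < 3 ^ cost T s
  leafIndex<3^cost (leaf _)        s = s≤s z≤n
  leafIndex<3^cost (cmp a b l e g) s = begin-strict
    leafIndex (cmp a b l e g) s ≡⟨ leafIndex-cmp a b l e g s ⟩
    rank o + leafIndex T' s * 3 <⟨ +-monoˡ-< _ (rank<3 o) ⟩
    suc (leafIndex T' s) * 3     ≤⟨ *-monoˡ-≤ 3 (onBranch o) ⟩
    3 ^ cost T' s * 3            ≡⟨ *-comm (3 ^ cost T' s) 3 ⟩
    3 ^ suc (cost T' s)          ≡⟨ cong (3 ^_) (cost-cmp a b l e g s) ⟨
    3 ^ cost (cmp a b l e g) s   ∎
    where
    open ≤-Reasoning
    o : Outcome
    o = outcomeAt s a b
    T' : CTree n R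
    T' = select o l e g
    onBranch : ∀ o → leafIndex (select o l e g) s < 3 ^ cost (select o l e g) s
    onBranch less    = leafIndex<3^cost l s
    onBranch equal   = leafIndex<3^cost e s
    onBranch greater = leafIndex<3^cost g s

  leafIndex-injective : ∀ T s t → leafIndex T s ≡ leafIndex T t → SamePath s t T
  leafIndex-injective (leaf _)        s t _ = leaf
  leafIndex-injective (cmp a b l e g) s t h = node o≡ (onBranch (outcomeAt s a b) i≡)
    where
    split : rank (outcomeAt s a b) ≡ rank (outcomeAt t a b) ×
            leafIndex (select (outcomeAt s a b) l e g) s ≡ leafIndex (select (outcomeAt t a b) l e g) t
    split = divMod-injective (rank<3 (outcomeAt s a b)) (rank<3 (outcomeAt t a b))
              (trans (sym (leafIndex-cmp a b l e g s)) (trans h (leafIndex-cmp a b l e g t)))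
    o≡ : outcomeAt s a b ≡ outcomeAt t a b
    o≡ = rank-injective (proj₁ split)
    i≡ : leafIndex (select (outcomeAt s a b) l e g) s ≡ leafIndex (select (outcomeAt s a b) l e g) t
    i≡ = trans (proj₂ split) (cong (λ o → leafIndex (select o l e g) t) (sym o≡))
    onBranch : ∀ o → leafIndex (select o l e g) s ≡ leafIndex (select o l e g) t →
               SamePath s t (select o l e g)
    onBranch less    = leafIndex-injective l s t
    onBranch equal   = leafIndex-injective e s t
    onBranch greater = leafIndex-injective g s t

  separated-family-cost : ∀ {N} .{{_ : NonZero N}} (T : CTree n R) (f : Fin N → String k n) →
                  (∀ {i j} → i <ᶠ j → ¬ SamePath (f i) (f j) T) →
                  ∃ λ i → N ≤ 3 ^ cost T (f i)
  separated-family-cost {N} T f separated =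
    let i , 3^c≰ = ¬∀⟶∃¬ N (λ i → 3 ^ cost T (f i) ≤ pred N) (λ i → _ ≤? pred N) noCollision
    in  i , subst (_≤ 3 ^ cost T (f i)) (suc-pred N) (≰⇒> 3^c≰)
    where
    noCollision : ¬ (∀ i → 3 ^ cost T (f i) ≤ pred N)
    noCollision small =
      let i , j , i<j , code≡ = pigeonhole (≤-reflexive (suc-pred N)) code
      in  separated i<j (leafIndex-injective T (f i) (f j)
          (trans (sym (toℕ-fromℕ< _)) (trans (cong toℕ code≡) (toℕ-fromℕ< _))))
      where
      code : Fin N → Fin (pred N)
      code i = fromℕ< (<-≤-trans (leafIndex<3^cost T (f i)) (small i))

-- Strings and closed repeats

‼-≥ : ∀ {A : Set} {n} (v : Vec A n) {P} → n ≤ P → v ‼ P ≡ nothing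
‼-≥ []      _         = refl
‼-≥ (_ ∷ v) (s≤s n≤P) = ‼-≥ v n≤P

‼-< : ∀ {A : Set} {n} (v : Vec A n) {P} → P < n → v ‼ P ≢ nothing
‼-< (_ ∷ v) {zero}  _         ()
‼-< (_ ∷ v) {suc P} (s≤s P<n) = ‼-< v P<n

tabulate-‼ : ∀ {A : Set} {n} (g : ℕ → A) {P} → P < n →
             tabulate {n = n} (g ∘ toℕ) ‼ P ≡ just (g P)
tabulate-‼ {n = suc n} g {zero}  _         = refl
tabulate-‼ {n = suc n} g {suc P} (s≤s P<n) = tabulate-‼ (g ∘ suc) P<n

module _ {k : ℕ} (f : ℕ → ℕ) (f<k : ∀ P → f P < k) where

  word : ∀ {n} → String k n
  word = tabulate (λ i → fromℕ< (f<k (toℕ i)))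

  word-‼-injective : ∀ {n P Q} → P < n → Q < n → word {n} ‼ P ≡ word {n} ‼ Q → f P ≡ f Q
  word-‼-injective {P = P} {Q} P<n Q<n eq = fromℕ<-injective (f P) (f Q) (f<k P) (f<k Q)
    (just-injective (trans (sym (tabulate-‼ (λ P → fromℕ< (f<k P)) P<n))
                    (trans eq (tabulate-‼ (λ P → fromℕ< (f<k P)) Q<n))))

  word-‼-cong : ∀ {n P Q} → P < n → Q < n → f P ≡ f Q → word {n} ‼ P ≡ word {n} ‼ Q
  word-‼-cong {P = P} {Q} P<n Q<n eq = trans (tabulate-‼ (λ P → fromℕ< (f<k P)) P<n)
    (trans (cong just (fromℕ<-cong (f P) (f Q) eq (f<k P) (f<k Q)))
           (sym (tabulate-‼ (λ P → fromℕ< (f<k P)) Q<n)))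

  outcomeAt-word : ∀ {n} (a b : Fin n) → outcomeAt word a b ≡ compareℕ (f (toℕ a)) (f (toℕ b))
  outcomeAt-word a b = trans (compareᶠ-toℕ _ _) (cong₂ compareℕ (toℕ-lookup a) (toℕ-lookup b))
    where
    toℕ-lookup : ∀ a → toℕ (lookup word a) ≡ f (toℕ a)
    toℕ-lookup a = trans (cong toℕ (lookup∘tabulate _ a)) (toℕ-fromℕ< (f<k (toℕ a)))

module _ {k n : ℕ} (s : String k n) where

  ShiftMatch : ℕ → ℕ → Set
  ShiftMatch δ x = s ‼ x ≡ s ‼ (x + δ)

  shiftMatch? : ∀ δ → Decidable (ShiftMatch δ)
  shiftMatch? δ x = ≡-dec _≟ᶠ_ (s ‼ x) (s ‼ (x + δ))

  occursAt-shift : ∀ {i j q p} → OccursAt s i j q → i ≤ p → p ≤ j → s ‼ (q + (p ∸ i)) ≡ s ‼ p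
  occursAt-shift (_ , match) i≤p p≤j =
    trans (match _ (∸-monoˡ-< (s≤s p≤j) i≤p)) (cong (s ‼_) (m+[n∸m]≡n i≤p))

  closedRepeat-recurrence : ∀ {i j p} → ClosedRepeat s i j → i ≤ p → p ≤ j →
                            ∃ λ P → p < P × P < n × s ‼ P ≡ s ‼ p
  closedRepeat-recurrence {i} {j} {p} (_ , _ , i' , i<i' , occ@(fits , _) , _) i≤p p≤j =
    i' + (p ∸ i) , m<o⇒n<o+[n∸m] i<i' i≤p ,
    <-≤-trans (+-monoʳ-< i' (∸-monoˡ-< (s≤s p≤j) i≤p)) fits , occursAt-shift occ i≤p p≤j

  private
    leftEnd : ∀ {i δ} → StartOfRun (ShiftMatch δ) i →
              i ≡ 0 ⊎ s ‼ (i ∸ 1) ≢ s ‼ ((i + δ) ∸ 1)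
    leftEnd (inj₁ i≡0)                  = inj₁ i≡0
    leftEnd (inj₂ (_ , refl , mismatch)) = inj₂ mismatch

  closedRepeat-intro : ∀ {i p j δ} → 0 < δ → i ≤ p → p ≤ j → j + δ < n →
                       ShiftMatch δ holdsOn[ i , j ] →
                       StartOfRun (ShiftMatch δ) i →
                       ¬ ShiftMatch δ (suc j) →
                       (∀ y → p < y → y < p + δ → s ‼ y ≢ s ‼ p) →
                       ClosedRepeat s i j
  closedRepeat-intro {i} {p} {j} {δ} δ>0 i≤p p≤j j+δ<n match start end fresh =
    i≤j , ≤-<-trans (m≤m+n j δ) j+δ<n , i + δ , m<m+n i δ>0 , occurs , noneBetween ,
    inj₂ (subst (λ x → s ‼ suc j ≢ s ‼ suc x) (sym (m+o+[n∸m]≡n+o δ i≤j)) end) , leftEnd start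
    where
    i≤j : i ≤ j
    i≤j = ≤-trans i≤p p≤j
    occurs : OccursAt s i j (i + δ)
    occurs = subst (_≤ n) (sym (m+o+[n∸m]≡n+o δ (m≤n⇒m≤1+n i≤j))) j+δ<n , λ t t<len →
      let i+t<1+j = subst (i + t <_) (m+[n∸m]≡n (m≤n⇒m≤1+n i≤j)) (+-monoʳ-< i t<len)
      in  sym (trans (match (i + t) (m≤m+n i t) (m<1+n⇒m≤n i+t<1+j))
                     (cong (s ‼_) (xy∙z≈xz∙y i t δ)))
    noneBetween : ∀ q → i < q → q < i + δ → ¬ OccursAt s i j q
    noneBetween q i<q q<i+δ occ =
      fresh (q + (p ∸ i)) (m<o⇒n<o+[n∸m] i<q i≤p)
            (subst (q + (p ∸ i) <_) (m+o+[n∸m]≡n+o δ i≤p) (+-monoˡ-< (p ∸ i) q<i+δ))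
            (occursAt-shift occ i≤p p≤j)

  closedRepeat-around : ∀ {p δ} → 0 < δ → p + δ < n → ShiftMatch δ p →
                        (∀ y → p < y → y < p + δ → s ‼ y ≢ s ‼ p) →
                        ∃₂ λ i j → ClosedRepeat s i j × i ≤ p × p ≤ j
  closedRepeat-around {p} {δ} δ>0 p+δ<n recur fresh =
    let i , i≤p , left , start        = run-leftwards (shiftMatch? δ) p recur
        j , p≤j , j<end , right , end = run-rightwards (shiftMatch? δ) (n ∸ δ ∸ p) recur
                                          (subst (¬_ ∘ ShiftMatch δ) (sym end≡) noMatchAtEnd)
        j+δ<n = subst (j + δ <_) (m∸n+n≡m δ≤n) (+-monoˡ-< δ (subst (j <_) end≡ j<end))
        match = holdsOn-join left right
    in  i , j , closedRepeat-intro δ>0 i≤p p≤j j+δ<n match start end fresh , i≤p , p≤j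
    where
    δ≤n : δ ≤ n
    δ≤n = ≤-trans (m≤n+m δ p) (<⇒≤ p+δ<n)
    p≤n∸δ : p ≤ n ∸ δ
    p≤n∸δ = m+n≤o⇒m≤o∸n p (<⇒≤ p+δ<n)
    end≡ : n ∸ δ ∸ p + p ≡ n ∸ δ
    end≡ = m∸n+n≡m p≤n∸δ
    -- Beyond the end both sides are nothing and match, so the run must be cut here.
    noMatchAtEnd : ¬ ShiftMatch δ (n ∸ δ)
    noMatchAtEnd match =
      ‼-< s (∸-monoʳ-< δ>0 δ≤n) (trans match (trans (cong (s ‼_) (m∸n+n≡m δ≤n)) (‼-≥ s ≤-refl)))

  closedRepeat-covering : ∀ {p p'} → p < p' → p' < n → s ‼ p' ≡ s ‼ p →
                          ∃₂ λ i j → ClosedRepeat s i j × i ≤ p × p ≤ j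
  closedRepeat-covering {p} {p'} p<p' p'<n recur
    with y , p<y , y≤end , recurY , fresh ←
           least-above (λ y → ≡-dec _≟ᶠ_ (s ‼ y) (s ‼ p)) (p' ∸ suc p) {suc p}
             (subst (λ x → s ‼ x ≡ s ‼ p) (sym (m∸n+n≡m p<p')) recur)
    = closedRepeat-around (m<n⇒0<n∸m p<y) (subst (_< n) (sym p+δ≡y) (≤-<-trans y≤p' p'<n))
        (sym (trans (cong (s ‼_) p+δ≡y) recurY))
        (λ x p<x x<p+δ → fresh x p<x (subst (x <_) p+δ≡y x<p+δ))
    where
    p+δ≡y : p + (y ∸ p) ≡ y
    p+δ≡y = m+[n∸m]≡n (<⇒≤ p<y)
    y≤p' : y ≤ p'
    y≤p' = subst (y ≤_) (m∸n+n≡m p<p') y≤end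

ListsClosedRepeats : ∀ {n} → ℕ → CTree n (List (ℕ × ℕ)) → Set
ListsClosedRepeats {n} k T = ∀ (s : String k n) i j → ((i , j) ∈ run T s) ⇔ ClosedRepeat s i j

closedRepeat-transfer : ∀ {k n} {T : CTree n (List (ℕ × ℕ))} {s u : String k n} {i j} →
                        ListsClosedRepeats k T → SamePath s u T → ClosedRepeat s i j → ClosedRepeat u i j
closedRepeat-transfer {s = s} {u} {i} {j} lists same repeat = Equivalence.to (lists u i j)
  (subst ((i , j) ∈_) (samePath-run same) (Equivalence.from (lists s i j) repeat))

atMostClosedRepeats-short : ∀ {k n} (s : String k n) ℓ .{{_ : NonZero ℓ}} →
                            (∀ {i j} → ClosedRepeat s i j → j < i + ℓ) → AtMostClosedRepeats s (ℓ * n)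
atMostClosedRepeats-short {n = n} s ℓ short =
  applyUpTo pair (ℓ * n) , ≤-reflexive (length-applyUpTo pair (ℓ * n)) , listed
  where
  pair : ℕ → ℕ × ℕ
  pair x = x / ℓ , x / ℓ + x % ℓ
  listed : ∀ i j → ClosedRepeat s i j → (i , j) ∈ applyUpTo pair (ℓ * n)
  listed i j repeat@(i≤j , j<n , _) =
    subst (_∈ applyUpTo pair (ℓ * n))
          (cong₂ _,_ quotient≡ (trans (cong₂ _+_ quotient≡ remainder≡) (m+[n∸m]≡n i≤j)))
      (∈-applyUpTo⁺ pair (begin-strict
        (j ∸ i) + i * ℓ <⟨ +-monoˡ-< (i * ℓ) d<ℓ ⟩
        suc i * ℓ       ≤⟨ *-monoˡ-≤ ℓ (≤-<-trans i≤j j<n) ⟩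
        n * ℓ           ≡⟨ *-comm n ℓ ⟩
        ℓ * n           ∎))
    where
    open ≤-Reasoning
    d<ℓ : j ∸ i < ℓ
    d<ℓ = subst (j ∸ i <_) (m+n∸m≡n i ℓ) (∸-monoˡ-< (short repeat) i≤j)
    quotient≡ : ((j ∸ i) + i * ℓ) / ℓ ≡ i
    quotient≡ = [r+q*d]/d≡q i d<ℓ
    remainder≡ : ((j ∸ i) + i * ℓ) % ℓ ≡ j ∸ i
    remainder≡ = [r+q*d]%d≡r i d<ℓ

-- The hard inputs

module Digits (K : ℕ) .{{_ : NonZero K}} where

  digit : ℕ → ℕ → ℕ
  digit zero    x = x % K
  digit (suc i) x = digit i (x / K)

  digit<K : ∀ i x → digit i x < K
  digit<K zero    x = m%n<n x K
  digit<K (suc i) x = digit<K i (x / K)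

  AgreeAbove : ℕ → ℕ → ℕ → Set
  AgreeAbove q x y = ∀ q' → q < q' → digit q' x ≡ digit q' y

  private
    quotient< : ∀ {e z} → z < K ^ suc e → z / K < K ^ e
    quotient< {e} {z} z< = m<n*o⇒m/o<n (subst (z <_) (*-comm K (K ^ e)) z<)

  highest-difference : ∀ e {x y} → x < K ^ e → y < K ^ e → x ≢ y →
                       ∃ λ q → q < e × digit q x ≢ digit q y × AgreeAbove q x y
  highest-difference zero x<1 y<1 x≢y = contradiction (trans (n<1⇒n≡0 x<1) (sym (n<1⇒n≡0 y<1))) x≢y
  highest-difference (suc e) {x} {y} x< y< x≢y with x / K ≟ y / K
  ... | yes x/K≡y/K = 0 , z<s , lowDiffers , higherAgree
    where
    lowDiffers : x % K ≢ y % K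
    lowDiffers x%K≡y%K = x≢y (begin
      x                 ≡⟨ m≡m%n+[m/n]*n x K ⟩
      x % K + x / K * K ≡⟨ cong₂ (λ r q → r + q * K) x%K≡y%K x/K≡y/K ⟩
      y % K + y / K * K ≡⟨ m≡m%n+[m/n]*n y K ⟨
      y                 ∎)
      where open ≡-Reasoning
    higherAgree : AgreeAbove 0 x y
    higherAgree (suc q') _ = cong (digit q') x/K≡y/K
  ... | no x/K≢y/K
    with q , q<e , differs , above ← highest-difference e (quotient< {e} x<) (quotient< {e} y<) x/K≢y/K
    = suc q , s≤s q<e , differs , λ { (suc q') (s≤s q<q') → above q' q<q' }

  digits-injective : ∀ e {x y} → x < K ^ e → y < K ^ e →
                     (∀ i → i < e → digit i x ≡ digit i y) → x ≡ y
  digits-injective e {x} {y} x< y< same with x ≟ y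
  ... | yes x≡y = x≡y
  ... | no x≢y with q , q<e , differs , _ ← highest-difference e x< y< x≢y =
    contradiction (same q q<e) differs

module HardWords (K e m : ℕ) .{{_ : NonZero K}} where

  open Digits K

  b : ℕ
  b = suc e

  W : ℕ
  W = K + K

  instance
    W-nonZero : NonZero W
    W-nonZero = >-nonZero (<-≤-trans (>-nonZero⁻¹ K) (m≤m+n K K))

  blockLetter : (ℕ → ℕ) → ℕ → ℕ → ℕ
  blockLetter pay q zero    = pay q
  blockLetter pay q (suc i) = K + digit i q

  letter : (ℕ → ℕ) → ℕ → ℕ
  letter pay P = blockLetter pay (P / b) (P % b)

  letter-block : ∀ pay q {r} → r < b → letter pay (r + q * b) ≡ blockLetter pay q r
  letter-block pay q r<b = cong₂ (blockLetter pay) ([r+q*d]/d≡q q r<b) ([r+q*d]%d≡r q r<b)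

  letter-cong : ∀ {pay pay'} P → (P % b ≡ 0 → pay (P / b) ≡ pay' (P / b)) → letter pay P ≡ letter pay' P
  letter-cong P agree with P % b
  ... | zero  = agree refl
  ... | suc i = refl

  module _ {pay : ℕ → ℕ} (pay<K : ∀ q → pay q < K) where

    blockLetter<W : ∀ q r → blockLetter pay q r < W
    blockLetter<W q zero    = <-≤-trans (pay<K q) (m≤m+n K K)
    blockLetter<W q (suc i) = +-monoʳ-< K (digit<K i q)

    blockLetter<K⇒start : ∀ q r → blockLetter pay q r < K → r ≡ 0
    blockLetter<K⇒start q zero    _     = refl
    blockLetter<K⇒start q (suc i) small = contradiction small (≤⇒≯ (m≤m+n K (digit i q)))

    window-unique : ∀ {X Y} → X + (b + b) ≤ K ^ e → Y + (b + b) ≤ K ^ e →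
                    (∀ t → t < b + b → letter pay (X + t) ≡ letter pay (Y + t)) → X ≡ Y
    window-unique {X} {Y} X+2b≤ Y+2b≤ same =
      +-cancelʳ-≡ o X Y (trans X+o≡ (trans (cong (_* b) qX≡qY) (sym Y+o≡)))
      where
      open ≡-Reasoning
      o : ℕ
      o = b ∸ X % b
      o<2b : ∀ {r} → r < b → o + r < b + b
      o<2b = +-mono-≤-< (m∸n≤m b (X % b))
      X+o≡ : X + o ≡ suc (X / b) * b
      X+o≡ = begin
        X + o                  ≡⟨ cong (_+ o) (m≡m%n+[m/n]*n X b) ⟩
        X % b + X / b * b + o  ≡⟨ xy∙z≈xz∙y (X % b) (X / b * b) o ⟩
        X % b + o + X / b * b  ≡⟨ cong (_+ X / b * b) (m+[n∸m]≡n (<⇒≤ (m%n<n X b))) ⟩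
        b + X / b * b          ∎
      blockAt : ∀ {Z q} → Z + o ≡ q * b → ∀ {r} → r < b →
                letter pay (Z + (o + r)) ≡ blockLetter pay q r
      blockAt {Z} {q} Z+o≡ {r} r<b = trans (cong (letter pay) (begin
        Z + (o + r)  ≡⟨ +-assoc Z o r ⟨
        Z + o + r    ≡⟨ cong (_+ r) Z+o≡ ⟩
        q * b + r    ≡⟨ +-comm (q * b) r ⟩
        r + q * b    ∎)) (letter-block pay q r<b)
      Y+o-start : (Y + o) % b ≡ 0
      Y+o-start = blockLetter<K⇒start _ _ (subst (_< K) (begin
        pay (suc (X / b))        ≡⟨ blockAt X+o≡ z<s ⟨
        letter pay (X + (o + 0)) ≡⟨ same (o + 0) (o<2b z<s) ⟩
        letter pay (Y + (o + 0)) ≡⟨ cong (λ t → letter pay (Y + t)) (+-identityʳ o) ⟩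
        letter pay (Y + o)       ∎) (pay<K _))
      Y+o≡ : Y + o ≡ (Y + o) / b * b
      Y+o≡ = trans (m≡m%n+[m/n]*n (Y + o) b) (cong (_+ (Y + o) / b * b) Y+o-start)
      blockIndex< : ∀ {Z q} → Z + o ≡ q * b → Z + (b + b) ≤ K ^ e → q < K ^ e
      blockIndex< {Z} {q} Z+o≡ Z+2b≤ =
        ≤-<-trans (m≤m*n q b) (<-≤-trans (subst (_< Z + (b + b)) Z+o≡ (+-monoʳ-< Z (o<2b′))) Z+2b≤)
        where
        o<2b′ : o < b + b
        o<2b′ = subst (_< b + b) (+-identityʳ o) (o<2b z<s)
      qX≡qY : suc (X / b) ≡ (Y + o) / b
      qX≡qY = digits-injective e (blockIndex< X+o≡ X+2b≤) (blockIndex< Y+o≡ Y+2b≤) λ i i<e →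
        +-cancelˡ-≡ K _ _ (trans (sym (blockAt X+o≡ (s≤s i<e)))
                          (trans (same _ (o<2b (s≤s i<e))) (blockAt Y+o≡ (s≤s i<e))))

  payload : ℕ → ℕ → ℕ
  payload c q with q <? m
  ... | yes _ = digit q c
  ... | no  _ = (q ∸ m) % K

  payload<K : ∀ c q → payload c q < K
  payload<K c q with q <? m
  ... | yes _ = digit<K q c
  ... | no  _ = m%n<n (q ∸ m) K

  payload-low : ∀ c {q} → q < m → payload c q ≡ digit q c
  payload-low c {q} q<m with q <? m
  ... | yes _   = refl
  ... | no  q≮m = contradiction q<m q≮m

  payload-high : ∀ c {a} → a < K → payload c (m + a) ≡ a
  payload-high c {a} a<K with m + a <? m
  ... | yes m+a<m = contradiction m+a<m (≤⇒≯ (m≤m+n m a))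
  ... | no  _     = trans (cong (_% K) (m+n∸m≡n m a)) (m<n⇒m%n≡m a<K)

  payload-agree : ∀ {c c' q} → AgreeAbove q c c' → ∀ {q'} → q < q' → payload c q' ≡ payload c' q'
  payload-agree above {q'} q<q' with q' <? m
  ... | yes _ = above q' q<q'
  ... | no  _ = refl

  hardLetter : ℕ → ℕ → ℕ
  hardLetter c = letter (payload c)

  hardLetter<W : ∀ c P → hardLetter c P < W
  hardLetter<W c P = blockLetter<W (payload<K c) (P / b) (P % b)

  hardLetter-payload : ∀ c q → hardLetter c (q * b) ≡ payload c q
  hardLetter-payload c q = letter-block (payload c) q z<s

  hardLetter-agree : ∀ {c c' q} → AgreeAbove q c c' → ∀ {P} → q * b < P →
                     hardLetter c P ≡ hardLetter c' P
  hardLetter-agree {q = q} above {P} qb<P = letter-cong P λ start →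
    payload-agree above (*-cancelʳ-< b q (P / b)
      (subst (q * b <_) (trans (m≡m%n+[m/n]*n P b) (cong (_+ P / b * b) start)) qb<P))

  module _ {k n : ℕ} (W*W≤k : W * W ≤ k) where

    private
      W≤k : W ≤ k
      W≤k = ≤-trans (m≤m*n W W) W*W≤k

    hardLetter<k : ∀ c P → hardLetter c P < k
    hardLetter<k c P = <-≤-trans (hardLetter<W c P) W≤k

    hardWord : ℕ → String k n
    hardWord c = word (hardLetter c) (hardLetter<k c)

    pairLetter : ℕ → ℕ → ℕ → ℕ
    pairLetter c c' P = hardLetter c' P + hardLetter c P * W

    pairLetter<W*W : ∀ c c' P → pairLetter c c' P < W * W
    pairLetter<W*W c c' P = <-≤-trans (+-monoˡ-< (hardLetter c P * W) (hardLetter<W c' P))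
                                      (*-monoˡ-≤ W (hardLetter<W c P))

    pairLetter<k : ∀ c c' P → pairLetter c c' P < k
    pairLetter<k c c' P = <-≤-trans (pairLetter<W*W c c' P) W*W≤k

    pairWord : ℕ → ℕ → String k n
    pairWord c c' = word (pairLetter c c') (pairLetter<k c c')

    pairWord-outcome : ∀ c c' x y → outcomeAt (hardWord c) x y ≡ outcomeAt (hardWord c') x y →
                       outcomeAt (hardWord c) x y ≡ outcomeAt (pairWord c c') x y
    pairWord-outcome c c' x y same = begin
      outcomeAt (hardWord c) x y
        ≡⟨ outcomeAt-word (hardLetter c) (hardLetter<k c) x y ⟩
      compareℕ (hardLetter c (toℕ x)) (hardLetter c (toℕ y))
        ≡⟨ compareℕ-pair W sameℕ ⟨
      compareℕ (pairLetter c c' (toℕ x)) (pairLetter c c' (toℕ y))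
        ≡⟨ outcomeAt-word (pairLetter c c') (pairLetter<k c c') x y ⟨
      outcomeAt (pairWord c c') x y
        ∎
      where
      open ≡-Reasoning
      sameℕ : compareℕ (hardLetter c (toℕ x)) (hardLetter c (toℕ y)) ≡
              compareℕ (hardLetter c' (toℕ x)) (hardLetter c' (toℕ y))
      sameℕ = trans (sym (outcomeAt-word (hardLetter c) (hardLetter<k c) x y))
                    (trans same (outcomeAt-word (hardLetter c') (hardLetter<k c') x y))

    payload-recurs : (m + K) * b ≤ n → ∀ c {q} → q < m →
                     ∃ λ p' → q * b < p' × p' < n × hardWord c ‼ p' ≡ hardWord c ‼ (q * b)
    payload-recurs fits c {q} q<m = (m + a) * b , *-monoˡ-< b (<-≤-trans q<m (m≤m+n m a)) , p'<n ,
      word-‼-cong (hardLetter c) (hardLetter<k c) p'<n (<-trans (*-monoˡ-< b (<-≤-trans q<m (m≤m+n m a))) p'<n)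
        (begin
          hardLetter c ((m + a) * b) ≡⟨ hardLetter-payload c (m + a) ⟩
          payload c (m + a)          ≡⟨ payload-high c (digit<K q c) ⟩
          a                          ≡⟨ payload-low c q<m ⟨
          payload c q                ≡⟨ hardLetter-payload c q ⟨
          hardLetter c (q * b)       ∎)
      where
      open ≡-Reasoning
      a : ℕ
      a = digit q c
      p'<n : (m + a) * b < n
      p'<n = <-≤-trans (m<n+m _ z<s) (≤-trans (*-monoˡ-≤ b (+-monoʳ-< m (digit<K q c))) fits)

    pairWord-echo : ∀ {c c' q P} → q < m → AgreeAbove q c c' → q * b < P → P < n →
                    pairWord c c' ‼ P ≡ pairWord c c' ‼ (q * b) → digit q c ≡ digit q c'
    pairWord-echo {c} {c'} {q} {P} q<m above qb<P P<n echo = begin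
      digit q c              ≡⟨ payload-low c q<m ⟨
      payload c q            ≡⟨ hardLetter-payload c q ⟨
      hardLetter c (q * b)   ≡⟨ proj₂ split ⟨
      hardLetter c P         ≡⟨ hardLetter-agree above qb<P ⟩
      hardLetter c' P        ≡⟨ proj₁ split ⟩
      hardLetter c' (q * b)  ≡⟨ hardLetter-payload c' q ⟩
      payload c' q           ≡⟨ payload-low c' q<m ⟩
      digit q c'             ∎
      where
      open ≡-Reasoning
      split : hardLetter c' P ≡ hardLetter c' (q * b) × hardLetter c P ≡ hardLetter c (q * b)
      split = divMod-injective (hardLetter<W c' P) (hardLetter<W c' (q * b))
                (word-‼-injective (pairLetter c c') (pairLetter<k c c') P<n (<-trans qb<P P<n) echo)

    hardWord-separated : ∀ {T} → ListsClosedRepeats k T → (m + K) * b ≤ n →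
                         ∀ {c c'} → c < K ^ m → c' < K ^ m → c ≢ c' →
                         ¬ SamePath (hardWord c) (hardWord c') T
    hardWord-separated lists fits {c} {c'} c< c'< c≢c' same =
      let q , q<m , differs , above = highest-difference m c< c'< c≢c'
          p' , p<p' , p'<n , recur   = payload-recurs fits c q<m
          i , j , repeat , i≤p , p≤j = closedRepeat-covering (hardWord c) p<p' p'<n recur
          sameU   = samePath-transfer {s = hardWord c} {hardWord c'} {pairWord c c'} (pairWord-outcome c c') same
          repeat′ = closedRepeat-transfer lists sameU repeat
          P , p<P , P<n , echo       = closedRepeat-recurrence (pairWord c c') repeat′ i≤p p≤j
      in  differs (pairWord-echo q<m above p<P P<n echo)

    hardWord-lower-bound : ∀ {T} → ListsClosedRepeats k T → (m + K) * b ≤ n →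
                           ∃ λ c → K ^ m ≤ 3 ^ cost T (hardWord c)
    hardWord-lower-bound {T} lists fits =
      let c , bound = separated-family-cost {{m^n≢0 K m}} T (hardWord ∘ toℕ) λ {i} {j} i<j →
                        hardWord-separated lists fits (toℕ<n i) (toℕ<n j) (<⇒≢ i<j)
      in  toℕ c , bound

    hardWord-short : ∀ c → n ≤ K ^ e → ∀ {i j} → ClosedRepeat (hardWord c) i j → j < i + (b + b)
    hardWord-short c n≤ {i} {j} (i≤j , j<n , i' , i<i' , (fits , match) , _) = ≰⇒> λ long →
      let 2b≤len  = m+n≤o⇒m≤o∸n (b + b) (subst (_≤ suc j) (+-comm i (b + b)) (m≤n⇒m≤1+n long))
          i'+2b≤n = ≤-trans (+-monoʳ-≤ i' 2b≤len) fits
          i+2b≤n  = ≤-trans long (<⇒≤ j<n)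
          window  = λ t t< → word-‼-injective (hardLetter c) (hardLetter<k c)
                               (<-≤-trans (+-monoʳ-< i' t<) i'+2b≤n) (<-≤-trans (+-monoʳ-< i t<) i+2b≤n)
                               (match t (<-≤-trans t< 2b≤len))
      in  <⇒≢ i<i' (sym (window-unique (payload<K c) (≤-trans i'+2b≤n n≤) (≤-trans i+2b≤n n≤)
                                       window))

-- Choice of parameters

-- K = 2^(⌊log₂ n⌋ / D) lies between n^(1/(2D)) and n^(1/D): small enough for an
-- alphabet of 4K² ≤ n^(1/d) letters, large enough that n ≤ K^e with e = 2D.
module Constants (d : ℕ) .{{_ : NonZero d}} where

  D e b Λ C c : ℕ
  D = 4 * d
  e = 2 * D
  b = suc e
  Λ = 4 * b * D
  C = b + b
  c = C * e * 2

  instance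
    D-nonZero : NonZero D
    D-nonZero = m*n≢0 4 d

    e-nonZero : NonZero e
    e-nonZero = m*n≢0 2 D

  1≤c : 1 ≤ c
  1≤c = >-nonZero⁻¹ c {{m*n≢0 (C * e) 2 {{m*n≢0 C e}}}}

  module _ {n : ℕ} (large : 2 ^ Λ ≤ n) where

    L κ K m : ℕ
    L = ⌊log₂ n ⌋
    κ = L / D
    K = 2 ^ κ
    m = n / b ∸ K

    instance
      K-nonZero : NonZero K
      K-nonZero = m^n≢0 2 κ

    open HardWords K e m using (hardWord; hardWord-lower-bound; hardWord-short)

    private
      open ≤-Reasoning

      1≤n : 1 ≤ n
      1≤n = ≤-trans (m^n>0 2 Λ) large

      κD≤L : κ * D ≤ L
      κD≤L = m/n*n≤m L D

      L<[1+κ]D : L < suc κ * D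
      L<[1+κ]D = subst (_< suc κ * D) (sym (m≡m%n+[m/n]*n L D)) (+-monoˡ-< (κ * D) (m%n<n L D))

      4b≤κ : 4 * b ≤ κ
      4b≤κ = subst (_≤ κ) (m*n/n≡m (4 * b) D) (/-monoˡ-≤ D (2^≤⇒≤⌊log₂⌋ large))

      1≤κ : 1 ≤ κ
      1≤κ = ≤-trans (s≤s z≤n) 4b≤κ

      D≤κD : D ≤ κ * D
      D≤κD = subst (_≤ κ * D) (*-identityˡ D) (*-monoˡ-≤ D 1≤κ)

      2^κD≤n : 2 ^ (κ * D) ≤ n
      2^κD≤n = ≤⌊log₂⌋⇒2^≤ (κ * D) 1≤n κD≤L

      4b≤K : 4 * b ≤ K
      4b≤K = <⇒≤ (≤-<-trans 4b≤κ (n<2^n κ))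

      2+κ+κ≤κ*4 : suc κ + suc κ ≤ κ * 4
      2+κ+κ≤κ*4 = begin
        suc κ + suc κ       ≡⟨ cong suc (+-suc κ κ) ⟩
        2 + (κ + κ)         ≤⟨ +-monoˡ-≤ (κ + κ) (+-mono-≤ 1≤κ 1≤κ) ⟩
        κ + κ + (κ + κ)     ≡⟨ four κ ⟨
        κ * 4               ∎
        where four : ∀ x → x * 4 ≡ x + x + (x + x)
              four = solve-∀

      κ+κ≤κ*4 : κ + κ ≤ κ * 4
      κ+κ≤κ*4 = ≤-trans (+-mono-≤ (n≤1+n κ) (n≤1+n κ)) 2+κ+κ≤κ*4

      κ*4≤κD : κ * 4 ≤ κ * D
      κ*4≤κD = *-monoʳ-≤ κ (*-monoʳ-≤ 4 (>-nonZero⁻¹ d))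

      K*K≤n : K * K ≤ n
      K*K≤n = begin
        K * K         ≡⟨ ^-distribˡ-+-* 2 κ κ ⟨
        2 ^ (κ + κ)   ≤⟨ ^-monoʳ-≤ 2 (≤-trans κ+κ≤κ*4 κ*4≤κD) ⟩
        2 ^ (κ * D)   ≤⟨ 2^κD≤n ⟩
        n             ∎

      1+L≤κe : suc L ≤ κ * e
      1+L≤κe = begin
        suc L             ≤⟨ L<[1+κ]D ⟩
        D + κ * D         ≤⟨ +-monoˡ-≤ (κ * D) D≤κD ⟩
        κ * D + κ * D     ≡⟨ double κ D ⟩
        κ * e             ∎
        where double : ∀ x y → x * y + x * y ≡ x * (2 * y)
              double = solve-∀

      K≤n/b : K ≤ n / b
      K≤n/b = subst (_≤ n / b) (m*n/n≡m K b) (/-monoˡ-≤ b (≤-trans (*-monoʳ-≤ K b≤K) K*K≤n))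
        where b≤K : b ≤ K
              b≤K = ≤-trans (m≤n*m b 4) 4b≤K

      [b+b]*[1+K]≤n : (b + b) * suc K ≤ n
      [b+b]*[1+K]≤n = begin
        (b + b) * suc K    ≤⟨ *-monoʳ-≤ (b + b) (+-monoˡ-≤ K (>-nonZero⁻¹ K)) ⟩
        (b + b) * (K + K)  ≡⟨ regroup b K ⟩
        4 * b * K          ≤⟨ *-monoˡ-≤ K 4b≤K ⟩
        K * K              ≤⟨ K*K≤n ⟩
        n                  ∎
        where regroup : ∀ x y → (x + x) * (y + y) ≡ 4 * x * y
              regroup = solve-∀

    W*W≤ : ∀ {k} → n ≤ k ^ d → (K + K) * (K + K) ≤ k
    W*W≤ {k} n≤k^d = ^-cancelˡ-≤ d (begin
      ((K + K) * (K + K)) ^ d     ≡⟨ cong (λ x → (x * x) ^ d) (cong (K +_) (sym (+-identityʳ K))) ⟩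
      (2 ^ suc κ * 2 ^ suc κ) ^ d ≡⟨ cong (_^ d) (^-distribˡ-+-* 2 (suc κ) (suc κ)) ⟨
      (2 ^ (suc κ + suc κ)) ^ d   ≡⟨ ^-*-assoc 2 (suc κ + suc κ) d ⟩
      2 ^ ((suc κ + suc κ) * d)   ≤⟨ ^-monoʳ-≤ 2 (*-monoˡ-≤ d 2+κ+κ≤κ*4) ⟩
      2 ^ (κ * 4 * d)             ≡⟨ cong (2 ^_) (*-assoc κ 4 d) ⟩
      2 ^ (κ * D)                 ≤⟨ 2^κD≤n ⟩
      n                           ≤⟨ n≤k^d ⟩
      k ^ d                       ∎)
      where open ≤-Reasoning

    n≤K^e : n ≤ K ^ e
    n≤K^e = begin
      n              <⟨ n<2^[1+⌊log₂n⌋] n ⟩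
      2 ^ suc L      ≤⟨ ^-monoʳ-≤ 2 1+L≤κe ⟩
      2 ^ (κ * e)    ≡⟨ ^-*-assoc 2 κ e ⟨
      K ^ e          ∎
      where open ≤-Reasoning

    fits : (m + K) * b ≤ n
    fits = subst (λ x → x * b ≤ n) (sym (m∸n+n≡m K≤n/b)) (m/n*n≤m n b)

    log-bound : ∀ {H} → K ^ m ≤ 3 ^ H → n * L ≤ c * H
    log-bound {H} K^m≤3^H = begin
      n * L            ≤⟨ *-mono-≤ (n≤[b+b]*[n/b∸K] b K [b+b]*[1+K]≤n) (<⇒≤ 1+L≤κe) ⟩
      C * m * (κ * e)  ≡⟨ rearrange C m κ e ⟩
      C * e * (κ * m)  ≤⟨ *-monoʳ-≤ (C * e) κm≤2H ⟩
      C * e * (2 * H)  ≡⟨ *-assoc (C * e) 2 H ⟨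
      c * H            ∎
      where
      open ≤-Reasoning
      rearrange : ∀ x y z w → x * y * (z * w) ≡ x * w * (z * y)
      rearrange = solve-∀
      κm≤2H : κ * m ≤ 2 * H
      κm≤2H = 2^-cancel-≤ (begin
        2 ^ (κ * m)  ≡⟨ ^-*-assoc 2 κ m ⟨
        K ^ m        ≤⟨ K^m≤3^H ⟩
        3 ^ H        ≤⟨ ^-monoˡ-≤ H (n≤1+n 3) ⟩
        4 ^ H        ≡⟨ ^-*-assoc 2 2 H ⟩
        2 ^ (2 * H)  ∎)

    hard-input : ∀ {k} → n ≤ k ^ d → (T : CTree n (List (ℕ × ℕ))) → ListsClosedRepeats k T →
                 Σ (String k n) λ s → AtMostClosedRepeats s (C * n) × n * ⌊log₂ n ⌋ ≤ c * cost T s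
    hard-input n≤k^d T lists =
      let c₀ , bound = hardWord-lower-bound (W*W≤ n≤k^d) {T} lists fits
          s          = hardWord (W*W≤ n≤k^d) c₀
      in  s , atMostClosedRepeats-short s C (hardWord-short (W*W≤ n≤k^d) c₀ n≤K^e) , log-bound bound

theorem3 : (σ : ℕ → ℕ) → PolyLowerBounded σ →
    Σ ℕ λ C →
      (A : ClosedRepeatAlgorithm σ) → ComputesClosedRepeats σ A →
        Σ ℕ λ c → (1 ≤ c) × Σ ℕ λ N → ∀ n → N ≤ n →
          Σ (String (σ n) n) λ s →
            AtMostClosedRepeats s (C * n) × (n * ⌊log₂ n ⌋ ≤ c * cost (A n) s)
theorem3 σ (d , 1≤d , N₀ , poly) = C , λ A computes → c , 1≤c , N₀ + 2 ^ Λ , λ n N≤n →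
  let large = ≤-trans (m≤n+m (2 ^ Λ) N₀) N≤n
      n≤σ^d = poly n (≤-trans (m≤m+n N₀ (2 ^ Λ)) N≤n)
  in  hard-input large n≤σ^d (A n) (computes n)
  where open Constants d {{>-nonZero 1≤d}}
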